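{- If $G$ is a connected graph with maximum degree $\Delta(G)\geq 5$ and $S(G)$ is its subdivision graph, then $\chi''_a(S(G))=\Delta(S(G))+1$ (i.e. $S(G)$ is of AVD-Type 1).
   Context: All graphs are simple, finite, undirected. The subdivision graph $S(G)$ has vertex set $V(G)\cup\{w_{u,v}:\{u,v\}\in E(G)\}$ and edges $\{u,w_{u,v}\}$, $\{w_{u,v},v\}$ for each $\{u,v\}\in E(G)$. $\Delta(H)$ is the maximum degree. A proper total coloring $f$ colors vertices and edges so that adjacent vertices, adjacent edges, and incident vertex-edge pairs get different colors. The color class of a vertex $u$ is $C_H(u)=\{f(u)\}\cup\{f(\{u,v\}):\{u,v\}\in E(H)\}$. An AVD-total coloring is a proper total coloring with $C_H(u)\neq C_H(v)$ for every edge $\{u,v\}$; $\chi''_a(H)$ is the least number of colors in an AVD-total coloring of $H$. -}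

module Defs where

open import Data.Nat using (ℕ; zero; suc; _⊔_; _<ᵇ_; _≤_)
open import Data.Fin using (Fin; toℕ)
open import Data.Fin.Properties using (_≟_)
open import Data.Bool using (Bool; true; false; T; _∧_; _∨_)
open import Data.Unit using (tt)
open import Data.List using (List; []; _∷_; [_]; _++_; map; concatMap; allFin; filterᵇ; length; foldr)
open import Data.Product using (Σ; _×_; _,_; proj₁; proj₂; ∃-syntax)
open import Data.Sum using (_⊎_; inj₁; inj₂)
open import Relation.Nullary using (¬_; Dec; yes; no)
open import Relation.Nullary.Decidable using (⌊_⌋)
open import Relation.Binary.PropositionalEquality using (_≡_; _≢_)
open import Function.Bundles using (_⇔_)

-- Generic finite simple graph data: a vertex type V, a Boolean adjacency
-- relation, and a list enumerating the vertices (each exactly once).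

degree : {V : Set} → (V → V → Bool) → List V → V → ℕ
degree adj vs u = length (filterᵇ (adj u) vs)

maxDegree : {V : Set} → (V → V → Bool) → List V → ℕ
maxDegree adj vs = foldr _⊔_ 0 (map (degree adj vs) vs)

-- Total colorings with k colors (colors are Fin k).
-- f colors vertices; g u v is the color of the edge {u,v} (only
-- meaningful when adj u v ≡ true).

InColorClass : {V : Set} {k : ℕ} → (V → V → Bool) →
               (V → Fin k) → (V → V → Fin k) → V → Fin k → Set
InColorClass adj f g u c = (f u ≡ c) ⊎ (∃[ v ] (T (adj u v) × g u v ≡ c))

record IsAVDTotalColoring {V : Set} (adj : V → V → Bool) (k : ℕ)
         (f : V → Fin k) (g : V → V → Fin k) : Set where
  field
    edge-sym     : ∀ u v → T (adj u v) → g u v ≡ g v u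
    vertex-prop  : ∀ u v → T (adj u v) → f u ≢ f v
    incident     : ∀ u v → T (adj u v) → f u ≢ g u v
    edge-prop    : ∀ u v w → T (adj u v) → T (adj u w) → v ≢ w → g u v ≢ g u w
    distinguish  : ∀ u v → T (adj u v) →
                   ¬ (∀ c → InColorClass adj f g u c ⇔ InColorClass adj f g v c)

HasAVDTotalColoring : {V : Set} → (V → V → Bool) → ℕ → Set
HasAVDTotalColoring {V} adj k =
  Σ (V → Fin k) λ f → Σ (V → V → Fin k) λ g → IsAVDTotalColoring adj k f g

AVDTotalChromaticNumberIs : {V : Set} → (V → V → Bool) → ℕ → Set
AVDTotalChromaticNumberIs adj m =
  HasAVDTotalColoring adj m × (∀ k → suc k ≤ m → ¬ HasAVDTotalColoring adj k)

record SimpleGraph (n : ℕ) : Set where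
  field
    adj    : Fin n → Fin n → Bool
    sym    : ∀ u v → adj u v ≡ adj v u
    irrefl : ∀ u → adj u u ≡ false

open SimpleGraph public

data Reachable {n : ℕ} (G : SimpleGraph n) : Fin n → Fin n → Set where
  here : ∀ {u} → Reachable G u u
  step : ∀ {u v w} → T (adj G u v) → Reachable G v w → Reachable G u w

Connected : {n : ℕ} → SimpleGraph n → Set
Connected {n} G = ∀ (u v : Fin n) → Reachable G u v

Δ : {n : ℕ} → SimpleGraph n → ℕ
Δ {n} G = maxDegree (adj G) (allFin n)

IsEdge : {n : ℕ} → SimpleGraph n → Fin n × Fin n → Bool
IsEdge G (u , v) = (toℕ u <ᵇ toℕ v) ∧ adj G u v

Edge : {n : ℕ} → SimpleGraph n → Set
Edge {n} G = Σ (Fin n × Fin n) λ p → T (IsEdge G p)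

private
  pick : {A : Set} (b : Bool) → (T b → A) → List A
  pick true  k = [ k tt ]
  pick false k = []

edgeList : {n : ℕ} (G : SimpleGraph n) → List (Edge G)
edgeList {n} G =
  concatMap (λ u → concatMap (λ v → pick (IsEdge G (u , v)) (λ e → ((u , v) , e)))
                             (allFin n))
            (allFin n)

SV : {n : ℕ} → SimpleGraph n → Set
SV {n} G = Fin n ⊎ Edge G

private
  _==_ : {n : ℕ} → Fin n → Fin n → Bool
  a == b = ⌊ a ≟ b ⌋

  incidentB : {n : ℕ} (G : SimpleGraph n) → Fin n → Edge G → Bool
  incidentB G x ((u , v) , _) = (x == u) ∨ (x == v)

SAdj : {n : ℕ} (G : SimpleGraph n) → SV G → SV G → Bool
SAdj G (inj₁ x) (inj₁ y) = false
SAdj G (inj₁ x) (inj₂ e) = incidentB G x e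
SAdj G (inj₂ e) (inj₁ x) = incidentB G x e
SAdj G (inj₂ e) (inj₂ f) = false

SVerts : {n : ℕ} (G : SimpleGraph n) → List (SV G)
SVerts {n} G = map inj₁ (allFin n) ++ map inj₂ (edgeList G)

ΔS : {n : ℕ} → SimpleGraph n → ℕ
ΔS G = maxDegree (SAdj G) (SVerts G)

-- Orient every edge of G from its smaller to its larger endpoint.  At each vertex x the
-- half-edges x–w_e of S(G) are labelled greedily with pairwise distinct colours, outgoing
-- ones first and incoming ones avoiding the label already chosen at the tail; then the
-- two halves of every edge differ, and x gets a colour missing from its labels.  A
-- subdivision vertex w_e, e = uv, has degree 2, so its colour only has to avoid four
-- colours: its two labels and, for each endpoint x with other endpoint y, a colour that then
-- lies in C(x) but not in C(w_e).  That colour is the colour of x, unless the label at y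
-- equals it; then it is another label at x, and if x has no other edge, the colour of w_e
-- itself is missing from C(x).  Avoiding four colours needs Δ(S(G)) ≥ 4, which follows from
-- Δ(G) ≥ 5 as Δ(G) ≤ Δ(S(G)).  No total colouring has fewer
-- colours, as a vertex of maximum degree and its edges need pairwise distinct ones.
module Submission where

open import Defs hiding (sym)
open import Data.Bool using (Bool; true; false; T; not; if_then_else_)
open import Data.Bool.Properties using (T-∨; T-∧; T-irrelevant)
open import Data.Empty using (⊥; ⊥-elim)
open import Data.Fin using (Fin; zero; toℕ)
open import Data.Fin.Properties using (_≟_; any?; toℕ-injective)
open import Data.List using (List; []; _∷_; [_]; _++_; map; concatMap; length; allFin; filterᵇ; removeAt)
open import Data.List.Properties using (length-++; length-map; length-tabulate; length-removeAt′)
import Data.List.Properties as List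
import Data.List.Relation.Unary.All as All
import Data.List.Relation.Unary.All.Properties as All
open import Data.List.Relation.Unary.Any as Any using (Any; here; there; index)
import Data.List.Relation.Unary.Any.Properties as Any
open import Data.List.Relation.Unary.Unique.Propositional using (Unique; []; _∷_)
open import Data.List.Relation.Unary.Unique.Propositional.Properties using (++⁺; map⁺; filter⁺; allFin⁺)
open import Data.List.Membership.Propositional using (_∈_; _∉_; find; lose)
open import Data.List.Membership.Propositional.Properties
  using ( ∈-map⁺; ∈-map⁻; ∈-++⁺ˡ; ∈-++⁺ʳ; ∈-filter⁺; ∈-filter⁻; ∈-allFin; ∈-concatMap⁺; ∈-concatMap⁻
        ; foldr-selective)
import Data.List.Membership.DecPropositional as DecMembership
open import Data.List.Relation.Binary.Subset.Propositional using (_⊆_)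
open import Data.Nat using (ℕ; suc; _+_; _⊔_; _≤_; _<_; z≤n; s≤s)
open import Data.Nat.Properties
  using ( ≤-trans; ≤-reflexive; ≤-pred; <-irrefl; ≤⇒≯; n≤1+n; +-suc; +-monoʳ-≤; m+n≤o⇒m≤o
        ; ⊔-lub; ⊔-sel; m≤m⊔n; m≤n⊔m; <ᵇ⇒<; <⇒<ᵇ; <-cmp; module ≤-Reasoning)
open import Data.Product as Product using (∃-syntax; _×_; _,_; proj₁; proj₂)
open import Data.Product.Properties using () renaming (≡-dec to Σ-≡-dec)
open import Data.Sum as Sum using (_⊎_; inj₁; inj₂)
open import Data.Sum.Properties using (inj₁-injective; inj₂-injective) renaming (≡-dec to ⊎-≡-dec)
open import Function using (_∘_; case_of_)
open import Function.Bundles using (Equivalence; _⇔_)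
open import Relation.Binary.Definitions using (DecidableEquality; tri<; tri≈; tri>)
open import Relation.Binary.PropositionalEquality
  using (_≡_; _≢_; refl; sym; trans; cong; cong₂; subst; module ≡-Reasoning)
open import Relation.Nullary using (¬_; Dec; does; yes; no; ¬?)
open import Relation.Nullary.Decidable
  using (decidable-stable; T?; ⌊_⌋; toWitness; fromWitness; dec-true; dec-false)

module _ {A : Set} where

  ∈-removeAt : ∀ {x y : A} {ys} (x∈ys : x ∈ ys) → y ∈ ys → y ≢ x → y ∈ removeAt ys (index x∈ys)
  ∈-removeAt (here refl)  (here refl)  y≢x = ⊥-elim (y≢x refl)
  ∈-removeAt (here refl)  (there y∈ys) _   = y∈ys
  ∈-removeAt (there _)    (here refl)  _   = here refl
  ∈-removeAt (there x∈ys) (there y∈ys) y≢x = there (∈-removeAt x∈ys y∈ys y≢x)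

  Unique⇒length≤ : ∀ {xs ys : List A} → Unique xs → xs ⊆ ys → length xs ≤ length ys
  Unique⇒length≤ {[]}     _ _ = z≤n
  Unique⇒length≤ {x ∷ xs} {ys} (x∉xs ∷ xs!) xs⊆ys = begin
    suc (length xs)                         ≤⟨ s≤s (Unique⇒length≤ xs! xs⊆ys-x) ⟩
    suc (length (removeAt ys (index x∈ys))) ≡⟨ length-removeAt′ ys (index x∈ys) ⟨
    length ys                               ∎
    where
    open ≤-Reasoning
    x∈ys = xs⊆ys (here refl)
    xs⊆ys-x : xs ⊆ removeAt ys (index x∈ys)
    xs⊆ys-x y∈xs = ∈-removeAt x∈ys (xs⊆ys (there y∈xs)) (All.lookup x∉xs y∈xs ∘ sym)

  Unique-map-on : ∀ {B : Set} (f : A → B) {xs} → (∀ {a b} → a ∈ xs → b ∈ xs → a ≢ b → f a ≢ f b) →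
                  Unique xs → Unique (map f xs)
  Unique-map-on f _ [] = []
  Unique-map-on f f-inj (x∉xs ∷ xs!) =
    All.map⁺ (All.tabulate λ y∈xs → f-inj (here refl) (there y∈xs) (All.lookup x∉xs y∈xs))
    ∷ Unique-map-on f (λ a∈ b∈ → f-inj (there a∈) (there b∈)) xs!

  Unique-concatMap : ∀ {B : Set} (f : A → List B) (tag : B → A) {xs} → Unique xs →
                     (∀ x → Unique (f x)) → (∀ x {y} → y ∈ f x → tag y ≡ x) → Unique (concatMap f xs)
  Unique-concatMap f tag [] _ _ = []
  Unique-concatMap f tag {x ∷ xs} (x∉xs ∷ xs!) f! tagged =
    ++⁺ (f! x) (Unique-concatMap f tag xs! f! tagged) disjoint
    where
    disjoint : ∀ {y} → ¬ (y ∈ f x × y ∈ concatMap f xs)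
    disjoint (y∈fx , y∈rest) with find (∈-concatMap⁻ f y∈rest)
    ... | x′ , x′∈xs , y∈fx′ = All.lookup x∉xs x′∈xs (trans (sym (tagged x y∈fx)) (tagged x′ y∈fx′))

  concatMap-≢ : ∀ {B : Set} {f g : A → List B} → DecidableEquality (List B) → ∀ xs →
                concatMap f xs ≢ concatMap g xs → ∃[ x ] f x ≢ g x
  concatMap-≢ _≟ᴸ_ []       ne = ⊥-elim (ne refl)
  concatMap-≢ {f = f} {g} _≟ᴸ_ (x ∷ xs) ne with f x ≟ᴸ g x
  ... | no fx≢gx  = x , fx≢gx
  ... | yes fx≡gx = concatMap-≢ _≟ᴸ_ xs (ne ∘ cong₂ _++_ fx≡gx)

  length-filterᵇ-split : ∀ (p : A → Bool) xs →
                         length (filterᵇ p xs) + length (filterᵇ (not ∘ p) xs) ≡ length xs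
  length-filterᵇ-split p []       = refl
  length-filterᵇ-split p (x ∷ xs) with p x
  ... | true  = cong suc (length-filterᵇ-split p xs)
  ... | false = trans (+-suc _ _) (cong suc (length-filterᵇ-split p xs))

  whenT : (b : Bool) → (T b → A) → List A
  whenT true  k = [ k _ ]
  whenT false k = []

  ∈-whenT⁺ : ∀ {b} (k : T b → A) (t : T b) → k t ∈ whenT b k
  ∈-whenT⁺ {true} k _ = here refl

  ∈-whenT⁻ : ∀ {b} {k : T b → A} {y} → y ∈ whenT b k → ∃[ t ] y ≡ k t
  ∈-whenT⁻ {true} (here y≡k) = _ , y≡k

  whenT-Unique : ∀ b (k : T b → A) → Unique (whenT b k)
  whenT-Unique true  k = All.[] ∷ []
  whenT-Unique false k = []

module _ {V : Set} (adj : V → V → Bool) (vs : List V) where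

  degree≤maxDegree : ∀ {v} → v ∈ vs → degree adj vs v ≤ maxDegree adj vs
  degree≤maxDegree {v} v∈vs =
    List.foldr-preservesᵒ {P = degree adj vs v ≤_}
      (λ a b → Sum.[ (λ p → ≤-trans p (m≤m⊔n a b)) , (λ p → ≤-trans p (m≤n⊔m a b)) ])
      0 (map (degree adj vs) vs) (inj₂ (Any.map⁺ (Any.map (λ { refl → ≤-reflexive refl }) v∈vs)))

  maxDegree-lub : ∀ m → (∀ v → degree adj vs v ≤ m) → maxDegree adj vs ≤ m
  maxDegree-lub m bound =
    List.foldr-preservesᵇ {P = _≤ m} {f = _⊔_} ⊔-lub z≤n
      (All.map⁺ (All.tabulate {xs = vs} λ {v} _ → bound v))

  maxDegree-attained : 0 < maxDegree adj vs → ∃[ v ] v ∈ vs × degree adj vs v ≡ maxDegree adj vs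
  maxDegree-attained 0<Δ with foldr-selective ⊔-sel 0 (map (degree adj vs) vs)
  ... | inj₁ Δ≡0 = ⊥-elim (<-irrefl (sym Δ≡0) 0<Δ)
  ... | inj₂ Δ∈  with ∈-map⁻ (degree adj vs) Δ∈
  ...   | v , v∈vs , Δ≡dv = v , v∈vs , sym Δ≡dv

  degree<colours : Unique vs → ∀ {k f g} → IsAVDTotalColoring adj k f g → ∀ v → degree adj vs v < k
  degree<colours vs! {k} {f} {g} colouring v = begin-strict
    degree adj vs v                ≡⟨ length-map (g v) neighbours ⟨
    length (map (g v) neighbours)  <⟨ Unique⇒length≤ colours! (λ {c} _ → ∈-allFin c) ⟩
    length (allFin k)              ≡⟨ length-tabulate (λ c → c) ⟩
    k                              ∎
    where
    open ≤-Reasoning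
    open IsAVDTotalColoring colouring
    neighbours = filterᵇ (adj v) vs
    adjacent : ∀ {w} → w ∈ neighbours → T (adj v w)
    adjacent = proj₂ ∘ ∈-filter⁻ (λ w → T? (adj v w)) {xs = vs}
    colours! : Unique (f v ∷ map (g v) neighbours)
    colours! = All.map⁺ (All.tabulate λ w∈ → incident v _ (adjacent w∈))
             ∷ Unique-map-on (g v) (λ w∈ w′∈ → edge-prop v _ _ (adjacent w∈) (adjacent w′∈))
                 (filter⁺ (λ w → T? (adj v w)) vs!)

  maxDegree<colours : Unique vs → 0 < maxDegree adj vs →
                      ∀ {k} → HasAVDTotalColoring adj k → maxDegree adj vs < k
  maxDegree<colours vs! 0<Δ (_ , _ , colouring) with maxDegree-attained 0<Δ
  ... | v , _ , dv≡Δ = subst (_< _) dv≡Δ (degree<colours vs! colouring v)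

module _ {d : ℕ} where

  open DecMembership (_≟_ {suc d}) using (_∈?_)

  fresh : List (Fin (suc d)) → Fin (suc d)
  fresh L with any? (λ c → ¬? (c ∈? L))
  ... | yes (c , _) = c
  ... | no _        = zero

  fresh-∉ : ∀ L → length L ≤ d → fresh L ∉ L
  fresh-∉ L |L|≤d with any? (λ c → ¬? (c ∈? L))
  ... | yes (_ , c∉L) = c∉L
  ... | no none       = ⊥-elim (≤⇒≯ |L|≤d (begin-strict
    d                        <⟨ s≤s (≤-reflexive refl) ⟩
    suc d                    ≡⟨ length-tabulate (λ c → c) ⟨
    length (allFin (suc d))  ≤⟨ Unique⇒length≤ (allFin⁺ (suc d)) allFin⊆L ⟩
    length L                 ∎))
    where
    open ≤-Reasoning
    allFin⊆L : allFin (suc d) ⊆ L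
    allFin⊆L {c} _ = decidable-stable (c ∈? L) (none ∘ (c ,_))

module Greedy {A : Set} (_≟ᴬ_ : DecidableEquality A) {d : ℕ} (forbidden : A → List (Fin (suc d))) where

  greedy : List (Fin (suc d)) → List A → A → Fin (suc d)
  greedy used []       s = zero
  greedy used (t ∷ ts) s with s ≟ᴬ t
  ... | yes _ = fresh (used ++ forbidden t)
  ... | no _  = greedy (fresh (used ++ forbidden t) ∷ used) ts s

  module _ (forbidden≤1 : ∀ s → length (forbidden s) ≤ 1) where

    private
      room-now : ∀ used t (ts : List A) →
                 length used + length (t ∷ ts) ≤ d → length (used ++ forbidden t) ≤ d
      room-now used t ts room = begin
        length (used ++ forbidden t)        ≡⟨ length-++ used ⟩
        length used + length (forbidden t)  ≤⟨ +-monoʳ-≤ (length used) (≤-trans (forbidden≤1 t) (s≤s z≤n)) ⟩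
        length used + suc (length ts)       ≤⟨ room ⟩
        d                                   ∎
        where open ≤-Reasoning

      room-next : ∀ (used : List (Fin (suc d))) (ts : List A) →
                  length used + suc (length ts) ≤ d → suc (length used) + length ts ≤ d
      room-next used ts room = ≤-trans (≤-reflexive (sym (+-suc (length used) (length ts)))) room

    greedy-∉ : ∀ used items → length used + length items ≤ d →
               ∀ {s} → s ∈ items → greedy used items s ∉ used ++ forbidden s
    greedy-∉ used (t ∷ ts) room {s} s∈ with s ≟ᴬ t
    ... | yes refl = fresh-∉ (used ++ forbidden t) (room-now used t ts room)
    ... | no s≢t   =
      greedy-∉ (fresh (used ++ forbidden t) ∷ used) ts (room-next used ts room) (Any.tail s≢t s∈) ∘ there

    greedy-injective : ∀ used items → length used + length items ≤ d →
                       ∀ {s s′} → s ∈ items → s′ ∈ items → s ≢ s′ → greedy used items s ≢ greedy used items s′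
    greedy-injective used (t ∷ ts) room {s} {s′} s∈ s′∈ s≢s′ with s ≟ᴬ t | s′ ≟ᴬ t
    ... | yes refl | yes refl = ⊥-elim (s≢s′ refl)
    ... | yes refl | no s′≢t  =
      greedy-∉ (fresh (used ++ forbidden t) ∷ used) ts (room-next used ts room) (Any.tail s′≢t s′∈) ∘ here ∘ sym
    ... | no s≢t   | yes refl =
      greedy-∉ (fresh (used ++ forbidden t) ∷ used) ts (room-next used ts room) (Any.tail s≢t s∈) ∘ here
    ... | no s≢t   | no s′≢t  =
      greedy-injective (fresh (used ++ forbidden t) ∷ used) ts (room-next used ts room)
        (Any.tail s≢t s∈) (Any.tail s′≢t s′∈) s≢s′

module Subdivision {n : ℕ} (G : SimpleGraph n) where

  V : Set
  V = SV G

  D : ℕ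
  D = ΔS G

  Colour : Set
  Colour = Fin (suc D)

  _≟ᴱ_ : DecidableEquality (Edge G)
  _≟ᴱ_ = Σ-≡-dec (Σ-≡-dec _≟_ _≟_) (λ p q → yes (T-irrelevant p q))

  _≟ⱽ_ : DecidableEquality V
  _≟ⱽ_ = ⊎-≡-dec _≟_ _≟ᴱ_

  open Greedy _≟ⱽ_

  edgesFrom : Fin n → Fin n → List (Edge G)
  edgesFrom u v = whenT (IsEdge G (u , v)) ((u , v) ,_)

  edges : List (Edge G)
  edges = concatMap (λ u → concatMap (edgesFrom u) (allFin n)) (allFin n)

  edgeList≡edges : edgeList G ≡ edges
  edgeList≡edges = decidable-stable (List.≡-dec _≟ᴱ_ (edgeList G) edges) no-difference
    where
    -- edgeList is built with a helper private to Defs; it only computes once IsEdge G (u , v)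
    -- is abstracted together with the pairing function whose type depends on it.
    no-difference : edgeList G ≢ edges → ⊥
    no-difference ne with concatMap-≢ (List.≡-dec _≟ᴱ_) (allFin n) ne
    ... | u , ne-u with concatMap-≢ (List.≡-dec _≟ᴱ_) (allFin n) ne-u
    ... | v , ne-uv
      with IsEdge G (u , v) | (λ (t : T (IsEdge G (u , v))) → _,_ {B = T ∘ IsEdge G} (u , v) t)
    ... | true  | _ = ne-uv refl
    ... | false | _ = ne-uv refl

  ∈-edges : ∀ e → e ∈ edges
  ∈-edges ((u , v) , t) =
    ∈-concatMap⁺ _ (lose (∈-allFin u) (∈-concatMap⁺ (edgesFrom u) (lose (∈-allFin v) (∈-whenT⁺ _ t))))

  edges-Unique : Unique edges
  edges-Unique =
    Unique-concatMap _ (proj₁ ∘ proj₁) (allFin⁺ n)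
      (λ u → Unique-concatMap (edgesFrom u) (proj₂ ∘ proj₁) (allFin⁺ n) (λ v → whenT-Unique _ _) head-tag)
      tail-tag
    where
    head-tag : ∀ {u} v {e} → e ∈ edgesFrom u v → proj₂ (proj₁ e) ≡ v
    head-tag v e∈ with ∈-whenT⁻ e∈
    ... | _ , refl = refl
    tail-tag : ∀ u {e} → e ∈ concatMap (edgesFrom u) (allFin n) → proj₁ (proj₁ e) ≡ u
    tail-tag u e∈ with find (∈-concatMap⁻ (edgesFrom u) {xs = allFin n} e∈)
    ... | v , _ , e∈′ with ∈-whenT⁻ e∈′
    ...   | _ , refl = refl

  ∈-SVerts : ∀ s → s ∈ SVerts G
  ∈-SVerts (inj₁ x) = ∈-++⁺ˡ (∈-map⁺ inj₁ (∈-allFin x))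
  ∈-SVerts (inj₂ e) =
    ∈-++⁺ʳ (map inj₁ (allFin n)) (∈-map⁺ inj₂ (subst (e ∈_) (sym edgeList≡edges) (∈-edges e)))

  SVerts-Unique : Unique (SVerts G)
  SVerts-Unique = ++⁺ (map⁺ inj₁-injective (allFin⁺ n))
                      (map⁺ inj₂-injective (subst Unique (sym edgeList≡edges) edges-Unique))
                      disjoint
    where
    disjoint : ∀ {s} → ¬ (s ∈ map inj₁ (allFin n) × s ∈ map inj₂ (edgeList G))
    disjoint (s∈₁ , s∈₂) with ∈-map⁻ inj₁ s∈₁ | ∈-map⁻ inj₂ s∈₂
    ... | _ , _ , refl | _ , _ , ()

  N : Fin n → List V
  N x = filterᵇ (SAdj G (inj₁ x)) (SVerts G)

  ∈-N⁺ : ∀ {x s} → T (SAdj G (inj₁ x) s) → s ∈ N x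
  ∈-N⁺ {s = s} = ∈-filter⁺ _ (∈-SVerts s)

  ∈-N⁻ : ∀ {x s} → s ∈ N x → T (SAdj G (inj₁ x) s)
  ∈-N⁻ = proj₂ ∘ ∈-filter⁻ _ {xs = SVerts G}

  |N|≤D : ∀ x → length (N x) ≤ D
  |N|≤D x = degree≤maxDegree (SAdj G) (SVerts G) (∈-SVerts (inj₁ x))

  module _ (x : Fin n) {u v : Fin n} (t : T (IsEdge G (u , v))) where

    incident⇒endpoint : T (SAdj G (inj₁ x) (inj₂ ((u , v) , t))) → x ≡ u ⊎ x ≡ v
    incident⇒endpoint = Sum.map toWitness toWitness ∘ Equivalence.to (T-∨ {⌊ x ≟ u ⌋} {⌊ x ≟ v ⌋})

    endpoint⇒incident : x ≡ u ⊎ x ≡ v → T (SAdj G (inj₁ x) (inj₂ ((u , v) , t)))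
    endpoint⇒incident =
      Equivalence.from (T-∨ {⌊ x ≟ u ⌋} {⌊ x ≟ v ⌋})
      ∘ Sum.map (fromWitness {a? = x ≟ u}) (fromWitness {a? = x ≟ v})

  tail≢head : ∀ {u v} → T (IsEdge G (u , v)) → u ≢ v
  tail≢head {u} t refl = <-irrefl refl (<ᵇ⇒< (toℕ u) (toℕ u) (proj₁ (Equivalence.to T-∧ t)))

  other : Fin n → V → Fin n
  other x (inj₁ y) = y
  other x (inj₂ ((u , v) , _)) with u ≟ x
  ... | yes _ = v
  ... | no _  = u

  edge-towards : ∀ {x y} → T (adj G x y) → ∃[ s ] s ∈ N x × other x s ≡ y
  edge-towards {x} {y} xy with <-cmp (toℕ x) (toℕ y)
  ... | tri< x<y _ _ = inj₂ ((x , y) , e) , ∈-N⁺ (endpoint⇒incident x e (inj₁ refl)) , from-tail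
    where
    e : T (IsEdge G (x , y))
    e = Equivalence.from T-∧ (<⇒<ᵇ x<y , xy)
    from-tail : other x (inj₂ ((x , y) , e)) ≡ y
    from-tail with x ≟ x
    ... | yes _  = refl
    ... | no x≢x = ⊥-elim (x≢x refl)
  ... | tri≈ _ x≡y _ rewrite toℕ-injective x≡y = ⊥-elim (subst T (irrefl G y) xy)
  ... | tri> _ _ y<x = inj₂ ((y , x) , e) , ∈-N⁺ (endpoint⇒incident x e (inj₂ refl)) , from-head
    where
    e : T (IsEdge G (y , x))
    e = Equivalence.from T-∧ (<⇒<ᵇ y<x , subst T (SimpleGraph.sym G x y) xy)
    from-head : other x (inj₂ ((y , x) , e)) ≡ y
    from-head with y ≟ x
    ... | yes y≡x = sym y≡x
    ... | no _    = refl

  Δ≤ΔS : Δ G ≤ D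
  Δ≤ΔS = maxDegree-lub (adj G) (allFin n) D λ x → begin
    degree (adj G) (allFin n) x   ≤⟨ Unique⇒length≤ (filter⁺ _ (allFin⁺ n)) (neighbours⊆ x) ⟩
    length (map (other x) (N x))  ≡⟨ length-map (other x) (N x) ⟩
    length (N x)                  ≤⟨ |N|≤D x ⟩
    D                             ∎
    where
    open ≤-Reasoning
    neighbours⊆ : ∀ x → filterᵇ (adj G x) (allFin n) ⊆ map (other x) (N x)
    neighbours⊆ x y∈ with edge-towards (proj₂ (∈-filter⁻ _ {xs = allFin n} y∈))
    ... | s , s∈ , refl = ∈-map⁺ (other x) s∈

  isTail : Fin n → V → Bool
  isTail x (inj₁ _)             = false
  isTail x (inj₂ ((u , _) , _)) = does (x ≟ u)

  outgoing incoming : Fin n → List V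
  outgoing x = filterᵇ (isTail x) (N x)
  incoming x = filterᵇ (not ∘ isTail x) (N x)

  ∈-outgoing : ∀ {x s} → s ∈ N x → isTail x s ≡ true → s ∈ outgoing x
  ∈-outgoing s∈ tail = ∈-filter⁺ _ s∈ (subst T (sym tail) _)

  ∈-incoming : ∀ {x s} → s ∈ N x → isTail x s ≡ false → s ∈ incoming x
  ∈-incoming s∈ head = ∈-filter⁺ _ s∈ (subst (T ∘ not) (sym head) _)

  |outgoing|+|incoming|≤D : ∀ x → length (outgoing x) + length (incoming x) ≤ D
  |outgoing|+|incoming|≤D x = ≤-trans (≤-reflexive (length-filterᵇ-split (isTail x) (N x))) (|N|≤D x)

  outLabel : Fin n → V → Colour
  outLabel x = greedy (λ _ → []) [] (outgoing x)

  labelAtTail : V → List Colour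
  labelAtTail (inj₁ _)             = []
  labelAtTail (inj₂ ((u , v) , t)) = [ outLabel u (inj₂ ((u , v) , t)) ]

  inLabel : Fin n → V → Colour
  inLabel x = greedy labelAtTail (map (outLabel x) (outgoing x)) (incoming x)

  label : Fin n → V → Colour
  label x s = if isTail x s then outLabel x s else inLabel x s

  label-out : ∀ {x s} → isTail x s ≡ true → label x s ≡ outLabel x s
  label-out tail rewrite tail = refl

  label-in : ∀ {x s} → isTail x s ≡ false → label x s ≡ inLabel x s
  label-in head rewrite head = refl

  module _ (x : Fin n) where

    private
      outRoom : length {A = Colour} [] + length (outgoing x) ≤ D
      outRoom = m+n≤o⇒m≤o _ (|outgoing|+|incoming|≤D x)

      inRoom : length (map (outLabel x) (outgoing x)) + length (incoming x) ≤ D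
      inRoom = subst (λ k → k + length (incoming x) ≤ D) (sym (length-map (outLabel x) (outgoing x)))
                 (|outgoing|+|incoming|≤D x)

      labelAtTail≤1 : ∀ s → length (labelAtTail s) ≤ 1
      labelAtTail≤1 (inj₁ _) = z≤n
      labelAtTail≤1 (inj₂ _) = s≤s z≤n

    inLabel-∉ : ∀ {s} → s ∈ incoming x → inLabel x s ∉ map (outLabel x) (outgoing x) ++ labelAtTail s
    inLabel-∉ = greedy-∉ labelAtTail labelAtTail≤1 _ (incoming x) inRoom

    label-injective : ∀ {s s′} → s ∈ N x → s′ ∈ N x → s ≢ s′ → label x s ≢ label x s′
    label-injective {s} {s′} s∈ s′∈ s≢s′ with isTail x s in tail | isTail x s′ in tail′
    ... | true  | true  = greedy-injective _ (λ _ → z≤n) [] (outgoing x) outRoom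
                            (∈-outgoing s∈ tail) (∈-outgoing s′∈ tail′) s≢s′
    ... | false | false = greedy-injective labelAtTail labelAtTail≤1 _ (incoming x) inRoom
                            (∈-incoming s∈ tail) (∈-incoming s′∈ tail′) s≢s′
    ... | true  | false = λ eq → inLabel-∉ (∈-incoming s′∈ tail′)
                            (∈-++⁺ˡ (subst (_∈ _) eq (∈-map⁺ (outLabel x) (∈-outgoing s∈ tail))))
    ... | false | true  = λ eq → inLabel-∉ (∈-incoming s∈ tail)
                            (∈-++⁺ˡ (subst (_∈ _) (sym eq) (∈-map⁺ (outLabel x) (∈-outgoing s′∈ tail′))))

  module _ {u v : Fin n} (t : T (IsEdge G (u , v))) where

    private
      w : V
      w = inj₂ ((u , v) , t)

    tail-incident : w ∈ N u
    tail-incident = ∈-N⁺ (endpoint⇒incident u t (inj₁ refl))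

    head-incident : w ∈ N v
    head-incident = ∈-N⁺ (endpoint⇒incident v t (inj₂ refl))

    label-tail≢label-head : label u w ≢ label v w
    label-tail≢label-head eq = inLabel-∉ v (∈-incoming head-incident head-not-tail) (∈-++⁺ʳ _ (here in≡out))
      where
      head-not-tail : isTail v w ≡ false
      head-not-tail = dec-false (v ≟ u) (tail≢head t ∘ sym)
      in≡out : inLabel v w ≡ outLabel u w
      in≡out = begin
        inLabel v w   ≡⟨ label-in head-not-tail ⟨
        label v w     ≡⟨ eq ⟨
        label u w     ≡⟨ label-out (dec-true (u ≟ u) refl) ⟩
        outLabel u w  ∎
        where open ≡-Reasoning

  vertexColour : Fin n → Colour
  vertexColour x = fresh (map (label x) (N x))

  vertexColour-fresh : ∀ {x s} → s ∈ N x → vertexColour x ≢ label x s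
  vertexColour-fresh {x} s∈ eq =
    fresh-∉ _ (≤-trans (≤-reflexive (length-map (label x) (N x))) (|N|≤D x))
      (subst (_∈ map (label x) (N x)) (sym eq) (∈-map⁺ (label x) s∈))

  module _ (x y : Fin n) (w : V) where

    -- Defined by cases on the two decisions rather than with a with-clause on
    -- label y w ≟ vertexColour x, which makes type-checking very slow.
    separatorBy : Dec (label y w ≡ vertexColour x) → Dec (Any (_≢ w) (N x)) → Colour
    separatorBy (no _)  _          = vertexColour x
    separatorBy (yes _) (yes some) = label x (proj₁ (find some))
    separatorBy (yes _) (no _)     = vertexColour x

    separator : Colour
    separator = separatorBy (label y w ≟ vertexColour x) (Any.any? (λ s → ¬? (s ≟ⱽ w)) (N x))

    vertexColour-∈ : ∀ {L} → label y w ∈ L → separator ∈ L → vertexColour x ∈ L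
    vertexColour-∈ {L} = by-cases (label y w ≟ vertexColour x) _
      where
      by-cases : ∀ d a → label y w ∈ L → separatorBy d a ∈ L → vertexColour x ∈ L
      by-cases (no _)      _ _   sep∈ = sep∈
      by-cases (yes ly≡vx) _ ly∈ _    = subst (_∈ L) ly≡vx ly∈

  forbiddenAt : Edge G → List Colour
  forbiddenAt e@((u , v) , _) =
    label u (inj₂ e) ∷ label v (inj₂ e) ∷ separator u v (inj₂ e) ∷ separator v u (inj₂ e) ∷ []

  subdivisionColour : Edge G → Colour
  subdivisionColour e = fresh (forbiddenAt e)

  vertexColouring : V → Colour
  vertexColouring (inj₁ x) = vertexColour x
  vertexColouring (inj₂ e) = subdivisionColour e

  edgeColouring : V → V → Colour
  edgeColouring (inj₁ x) s        = label x s
  edgeColouring (inj₂ e) (inj₁ x) = label x (inj₂ e)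
  edgeColouring (inj₂ _) (inj₂ _) = zero

  ColourClass : V → Colour → Set
  ColourClass = InColorClass (SAdj G) vertexColouring edgeColouring

  Separates : Colour → V → V → Set
  Separates c p q = ColourClass p c × ¬ ColourClass q c

  Separated : V → V → Set
  Separated p q = ∃[ c ] (Separates c p q ⊎ Separates c q p)

  separated⇒distinct : ∀ {p q} → Separated p q → ¬ (∀ c → ColourClass p c ⇔ ColourClass q c)
  separated⇒distinct (c , inj₁ (p∋c , q∌c)) same = q∌c (Equivalence.to (same c) p∋c)
  separated⇒distinct (c , inj₂ (q∋c , p∌c)) same = p∌c (Equivalence.from (same c) q∋c)

  module _ {u v : Fin n} (t : T (IsEdge G (u , v))) where

    private
      w : V
      w = inj₂ ((u , v) , t)

    subdivision-class : ∀ {c} → ColourClass w c →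
                        subdivisionColour ((u , v) , t) ≡ c ⊎ label u w ≡ c ⊎ label v w ≡ c
    subdivision-class (inj₁ eq)                 = inj₁ eq
    subdivision-class (inj₂ (inj₁ z , zw , eq)) = inj₂ (at-endpoint (incident⇒endpoint z t zw) eq)
      where
      at-endpoint : ∀ {z c} → z ≡ u ⊎ z ≡ v → label z w ≡ c → label u w ≡ c ⊎ label v w ≡ c
      at-endpoint (inj₁ refl) eq = inj₁ eq
      at-endpoint (inj₂ refl) eq = inj₂ eq

  module _ (4≤D : 4 ≤ D) where

    subdivisionColour-fresh : ∀ e → subdivisionColour e ∉ forbiddenAt e
    subdivisionColour-fresh e = fresh-∉ (forbiddenAt e) 4≤D

    endpoint-separated :
      ∀ x y e → inj₂ e ∈ N x → label x (inj₂ e) ∈ forbiddenAt e → separator x y (inj₂ e) ∈ forbiddenAt e →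
      (∀ {c} → ColourClass (inj₂ e) c →
               subdivisionColour e ≡ c ⊎ label x (inj₂ e) ≡ c ⊎ label y (inj₂ e) ≡ c) →
      Separated (inj₁ x) (inj₂ e)
    endpoint-separated x y e w∈ lx∈ sep∈ class = by-cases (label y (inj₂ e) ≟ vertexColour x) _ sep∈
      where
      by-cases : ∀ d a → separatorBy x y (inj₂ e) d a ∈ forbiddenAt e → Separated (inj₁ x) (inj₂ e)
      by-cases (no ly≢vx) _ sep∈ = vertexColour x , inj₁ (inj₁ refl , λ w∋vx → case class w∋vx of λ where
        (inj₁ sc≡vx)        → subdivisionColour-fresh e (subst (_∈ _) (sym sc≡vx) sep∈)
        (inj₂ (inj₁ lx≡vx)) → vertexColour-fresh w∈ (sym lx≡vx)
        (inj₂ (inj₂ ly≡vx)) → ly≢vx ly≡vx)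
      by-cases (yes ly≡vx) (yes some) sep∈ = let s , s∈ , s≢w = find some in
        label x s , inj₁ (inj₂ (s , ∈-N⁻ s∈ , refl) , λ w∋lxs → case class w∋lxs of λ where
          (inj₁ sc≡lxs)         → subdivisionColour-fresh e (subst (_∈ _) (sym sc≡lxs) sep∈)
          (inj₂ (inj₁ lxw≡lxs)) → label-injective x w∈ s∈ (s≢w ∘ sym) lxw≡lxs
          (inj₂ (inj₂ lyw≡lxs)) → vertexColour-fresh s∈ (trans (sym ly≡vx) lyw≡lxs))
      by-cases (yes ly≡vx) (no none) sep∈ = subdivisionColour e , inj₂ (inj₁ refl , λ where
        (inj₁ vx≡sc)             → subdivisionColour-fresh e (subst (_∈ _) vx≡sc sep∈)
        (inj₂ (z , xz , lxz≡sc)) → subdivisionColour-fresh e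
                                     (subst (_∈ _) (trans (cong (label x) (only-w (∈-N⁺ xz))) lxz≡sc) lx∈))
        where
        only-w : ∀ {z} → z ∈ N x → inj₂ e ≡ z
        only-w {z} z∈ = sym (decidable-stable (z ≟ⱽ inj₂ e) (none ∘ lose z∈))

    module _ {u v : Fin n} (t : T (IsEdge G (u , v))) where

      private
        e : Edge G
        e = (u , v) , t

      endpoint-label-∈ : ∀ {x} → x ≡ u ⊎ x ≡ v → label x (inj₂ e) ∈ forbiddenAt e
      endpoint-label-∈ (inj₁ refl) = here refl
      endpoint-label-∈ (inj₂ refl) = there (here refl)

      endpoint-vertexColour-∈ : ∀ {x} → x ≡ u ⊎ x ≡ v → vertexColour x ∈ forbiddenAt e
      endpoint-vertexColour-∈ (inj₁ refl) = vertexColour-∈ u v _ (there (here refl)) (there (there (here refl)))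
      endpoint-vertexColour-∈ (inj₂ refl) = vertexColour-∈ v u _ (here refl) (there (there (there (here refl))))

      incident-separated : ∀ {x} → x ≡ u ⊎ x ≡ v → Separated (inj₁ x) (inj₂ e)
      incident-separated (inj₁ refl) =
        endpoint-separated u v e (tail-incident t) (here refl) (there (there (here refl))) (subdivision-class t)
      incident-separated (inj₂ refl) =
        endpoint-separated v u e (head-incident t) (there (here refl)) (there (there (there (here refl))))
          (Sum.map₂ Sum.swap ∘ subdivision-class t)

    colouring : IsAVDTotalColoring (SAdj G) (suc D) vertexColouring edgeColouring
    colouring = record
      { edge-sym    = edge-sym
      ; vertex-prop = vertex-prop
      ; incident    = incident
      ; edge-prop   = edge-prop
      ; distinguish = distinguish
      }
      where
      edge-sym : ∀ p q → T (SAdj G p q) → edgeColouring p q ≡ edgeColouring q p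
      edge-sym (inj₁ _) (inj₂ _) _ = refl
      edge-sym (inj₂ _) (inj₁ _) _ = refl

      vertex-prop : ∀ p q → T (SAdj G p q) → vertexColouring p ≢ vertexColouring q
      vertex-prop (inj₁ x) (inj₂ (_ , t)) xw eq =
        subdivisionColour-fresh _ (subst (_∈ _) eq (endpoint-vertexColour-∈ t (incident⇒endpoint x t xw)))
      vertex-prop (inj₂ (_ , t)) (inj₁ x) wx eq =
        subdivisionColour-fresh _
          (subst (_∈ _) (sym eq) (endpoint-vertexColour-∈ t (incident⇒endpoint x t wx)))

      incident : ∀ p q → T (SAdj G p q) → vertexColouring p ≢ edgeColouring p q
      incident (inj₁ x) (inj₂ _) xw = vertexColour-fresh (∈-N⁺ xw)
      incident (inj₂ (_ , t)) (inj₁ x) wx eq =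
        subdivisionColour-fresh _ (subst (_∈ _) (sym eq) (endpoint-label-∈ t (incident⇒endpoint x t wx)))

      edge-prop : ∀ p q r → T (SAdj G p q) → T (SAdj G p r) → q ≢ r → edgeColouring p q ≢ edgeColouring p r
      edge-prop (inj₁ x) _ _ xq xr q≢r = label-injective x (∈-N⁺ xq) (∈-N⁺ xr) q≢r
      edge-prop (inj₂ (_ , t)) (inj₁ x) (inj₁ y) wx wy x≢y
        with incident⇒endpoint x t wx | incident⇒endpoint y t wy
      ... | inj₁ refl | inj₁ refl = ⊥-elim (x≢y refl)
      ... | inj₁ refl | inj₂ refl = label-tail≢label-head t
      ... | inj₂ refl | inj₁ refl = label-tail≢label-head t ∘ sym
      ... | inj₂ refl | inj₂ refl = ⊥-elim (x≢y refl)

      distinguish : ∀ p q → T (SAdj G p q) → ¬ (∀ c → ColourClass p c ⇔ ColourClass q c)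
      distinguish (inj₁ x) (inj₂ e@(_ , t)) xw =
        separated⇒distinct {inj₁ x} {inj₂ e} (incident-separated t (incident⇒endpoint x t xw))
      distinguish (inj₂ e@(_ , t)) (inj₁ x) wx =
        separated⇒distinct {inj₂ e} {inj₁ x}
          (Product.map₂ Sum.swap (incident-separated t (incident⇒endpoint x t wx)))

theorem5p3 : ∀ (n : ℕ) (G : SimpleGraph n) → Connected G → 5 ≤ Δ G →
    AVDTotalChromaticNumberIs (SAdj G) (suc (ΔS G))
theorem5p3 n G _ 5≤Δ = (vertexColouring , edgeColouring , colouring 4≤D) , no-fewer-colours
  where
  open Subdivision G
  5≤D : 5 ≤ D
  5≤D = ≤-trans 5≤Δ Δ≤ΔS
  4≤D : 4 ≤ D
  4≤D = ≤-trans (n≤1+n 4) 5≤D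
  no-fewer-colours : ∀ k → suc k ≤ suc D → ¬ HasAVDTotalColoring (SAdj G) k
  no-fewer-colours k k<1+D colouring = ≤⇒≯ (≤-pred k<1+D)
    (maxDegree<colours (SAdj G) (SVerts G) SVerts-Unique (≤-trans (s≤s z≤n) 5≤D) colouring)
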